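{- Let $M$ be a finite matroid on ground set $E$ with rank function $r$ and set of bases $\mathcal{B}(M)$. Let $E_1,\dots,E_k\subseteq E$, and let $\phi$ be any bijection from $\mathcal{P}(E_1,\dots,E_k)$ to $\mathcal{Q}(E_1,\dots,E_k)$. (i) Suppose $k=|E|-r(M)$, each $E_i$ is a union of some circuits of $M$, and $\bigvee_{i\in I}E_i$ contains a circuit of $M$ for every non-empty $I\subseteq N_k$. Then $\mathcal{B}(M)=\{E-D: D\in\mathcal{Q}(E_1,\dots,E_k)\}$, and $f\mapsto E-\phi(f)$ is a bijection from $\mathcal{P}(E_1,\dots,E_k)$ to $\mathcal{B}(M)$. (ii) Suppose $k=r(M)$, each $E_i$ is a union of some cocircuits of $M$, and $\bigvee_{i\in I}E_i$ contains a cocircuit of $M$ for every non-empty $I\subseteq N_k$. Then $\mathcal{B}(M)=\mathcal{Q}(E_1,\dots,E_k)$, and $f\mapsto\phi(f)$ is a bijection from $\mathcal{P}(E_1,\dots,E_k)$ to $\mathcal{B}(M)$.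
   Context: $N_k=\{1,\dots,k\}$ and $\mathbb{N}_0$ is the set of non-negative integers. For sets $E_j$, $j\in I$, $\bigvee_{j\in I}E_j$ denotes the set of elements belonging to exactly one of the $E_j$, $j\in I$. $\mathcal{P}(E_1,\dots,E_k)$ is the set of mappings $f:\{E_i:i\in N_k\}\to\mathbb{N}_0$ such that for every non-empty $I\subseteq N_k$ there is $i\in I$ with $|E_i\cap\bigvee_{j\in I}E_j|>f(E_i)$. $\mathcal{Q}(E_1,\dots,E_k)$ is the set of $k$-element sets $D$ such that $D\cap\bigvee_{j\in I}E_j\neq\emptyset$ for every non-empty $I\subseteq N_k$. -}

module Defs where

open import Data.Nat using (ℕ; _<_; _≤_; _≟_)
open import Data.Bool using (Bool; _∧_)
open import Data.Fin using (Fin)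
open import Data.Fin.Subset using (Subset; _∈_; _∉_; _⊆_; _⊂_; _∩_; _∪_; ⁅_⁆; ∣_∣; ⊥; Nonempty; Empty; ∁)
open import Data.Vec using (Vec; lookup; tabulate)
open import Data.Product using (Σ; ∃; _×_; Σ-syntax; ∃-syntax)
open import Relation.Nullary using (¬_; Dec)
open import Relation.Nullary.Decidable using (⌊_⌋)
open import Relation.Binary.PropositionalEquality using (_≡_)

record Matroid (n : ℕ) : Set₁ where
  field
    Indep       : Subset n → Set
    indep?      : ∀ A → Dec (Indep A)
    indep-empty : Indep ⊥
    indep-down  : ∀ {A B} → B ⊆ A → Indep A → Indep B
    indep-aug   : ∀ {A B} → Indep A → Indep B → ∣ A ∣ < ∣ B ∣ →
                  ∃[ x ] (x ∈ B × x ∉ A × Indep (A ∪ ⁅ x ⁆))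

module _ {n : ℕ} (M : Matroid n) where
  open Matroid M

  IsBasis : Subset n → Set
  IsBasis B = Indep B × (∀ A → Indep A → B ⊆ A → A ≡ B)

  IsRank : ℕ → Set
  IsRank r = (∀ A → Indep A → ∣ A ∣ ≤ r) × (∃[ A ] (Indep A × ∣ A ∣ ≡ r))

  IsCircuit : Subset n → Set
  IsCircuit C = ¬ Indep C × (∀ A → A ⊂ C → Indep A)

  -- cocircuits: circuits of the dual matroid M*, whose bases are the
  -- complements E - B of bases B of M; a set is dependent in M* iff it
  -- is contained in no E - B, i.e. iff it meets every basis of M.
  IsCocircuit : Subset n → Set
  IsCocircuit C = (∀ B → IsBasis B → Nonempty (C ∩ B))
                × (∀ A → A ⊂ C → ∃[ B ] (IsBasis B × Empty (A ∩ B)))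

IsUnionOf : {n : ℕ} → (Subset n → Set) → Subset n → Set
IsUnionOf Good X = ∀ x → x ∈ X → ∃[ C ] (Good C × x ∈ C × C ⊆ X)

-- ⋁_{j ∈ I} E_j : elements lying in exactly one E_j with j ∈ I
⋁ : {n k : ℕ} → (Fin k → Subset n) → Subset k → Subset n
⋁ {n} {k} E I = tabulate λ x → ⌊ ∣ tabulate (λ j → lookup I j ∧ lookup (E j) x) ∣ ≟ 1 ⌋

-- f ∈ 𝒫(E_1,…,E_k), with f(E_i) written lookup f i
InP : {n k : ℕ} → (Fin k → Subset n) → Vec ℕ k → Set
InP E f = ∀ I → Nonempty I → ∃[ i ] (i ∈ I × lookup f i < ∣ E i ∩ ⋁ E I ∣)

InQ : {n k : ℕ} → (Fin k → Subset n) → Subset n → Set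
InQ {k = k} E D = ∣ D ∣ ≡ k × (∀ I → Nonempty I → Nonempty (D ∩ ⋁ E I))

-- φ is a bijection from {a | P a} to {b | Q b} (a map defined on elements a
-- together with a proof of P a, not depending on that proof)
IsBijection : {A B : Set} → (P : A → Set) → (Q : B → Set) → ((a : A) → P a → B) → Set
IsBijection {A} {B} P Q φ =
    (∀ a (p p' : P a) → φ a p ≡ φ a p')
  × (∀ a (p : P a) → Q (φ a p))
  × (∀ a a' (p : P a) (p' : P a') → φ a p ≡ φ a' p' → a ≡ a')
  × (∀ b → Q b → Σ[ a ∈ A ] Σ[ p ∈ P a ] φ a p ≡ b)

-- Both parts rest on one peeling argument. If D ∈ 𝒬(E₁,…,E_k), then for the
-- still-unused indices I the set D meets ⋁_{j∈I} E_j in some d lying in exactly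
-- one E_j with j ∈ I; remove j from I and move d into T. Every E_i with i still
-- in I avoids the growing part T of D, and after k steps T = D. In (i) the
-- element d lies on a circuit inside E_j ⊆ E − T, so deleting d does not lower
-- the rank of E − T, and E − D keeps rank r(M) = |E − D|: it is a basis. In (ii)
-- d lies on a cocircuit inside E_j, which avoids the independent set T, so T + d
-- stays independent and D is an independent set of size r(M). Conversely the
-- complement of a basis meets every circuit, and a basis meets every cocircuit.
module Submission where

open import Defs
open import Data.Nat using (ℕ; zero; suc; _+_; _∸_; _≤_; _<_; _≟_; _≤?_; s≤s⁻¹)
open import Data.Nat.Properties
open import Data.Bool using (Bool; T; _∧_)
open import Data.Bool.Properties using (T-≡; T-∧)
open import Data.Fin using (Fin; zero; suc) renaming (_≟_ to _≟ᶠ_)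
open import Data.Fin.Subset
open import Data.Fin.Subset.Properties
open import Data.Fin.Properties using (any?)
open import Data.Vec using (Vec; []; _∷_; lookup; tabulate; here; there)
open import Data.Vec.Properties using ([]=⇒lookup; lookup⇒[]=; lookup∘tabulate)
open import Data.Product using (_×_; _,_; proj₁; proj₂; ∃-syntax)
open import Data.Sum using (inj₁; inj₂; [_,_]′)
open import Function using (_∘_)
open import Function.Bundles using (_⇔_; mk⇔; Equivalence)
open import Relation.Nullary using (¬_; yes; no; contradiction)
open import Relation.Nullary.Decidable using (_×-dec_; ¬?; toWitness)
open import Relation.Binary.PropositionalEquality

private
  variable
    n k : ℕ

∁-involutive : (p : Subset n) → ∁ (∁ p) ≡ p
∁-involutive []            = refl
∁-involutive (inside ∷ p)  = cong (inside ∷_) (∁-involutive p)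
∁-involutive (outside ∷ p) = cong (outside ∷_) (∁-involutive p)

x∈p─q⁻ : ∀ (p q : Subset n) {x} → x ∈ p ─ q → x ∈ p × x ∉ q
x∈p─q⁻ (inside ∷ p)  (outside ∷ q) here       = here , λ ()
x∈p─q⁻ (inside ∷ p)  (inside ∷ q)  {zero} ()
x∈p─q⁻ (outside ∷ p) (inside ∷ q)  {zero} ()
x∈p─q⁻ (outside ∷ p) (outside ∷ q) {zero} ()
x∈p─q⁻ (_ ∷ p)       (_ ∷ q)       (there x∈) =
  there (proj₁ (x∈p─q⁻ p q x∈)) , λ x∈q → proj₂ (x∈p─q⁻ p q x∈) (drop-there x∈q)

p⊆q∧∣q∣≤∣p∣⇒p≡q : ∀ {p q : Subset n} → p ⊆ q → ∣ q ∣ ≤ ∣ p ∣ → p ≡ q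
p⊆q∧∣q∣≤∣p∣⇒p≡q {p = []}          {[]}          _   _       = refl
p⊆q∧∣q∣≤∣p∣⇒p≡q {p = outside ∷ p} {outside ∷ q} p⊆q ∣q∣≤∣p∣ =
  cong (outside ∷_) (p⊆q∧∣q∣≤∣p∣⇒p≡q (drop-∷-⊆ p⊆q) ∣q∣≤∣p∣)
p⊆q∧∣q∣≤∣p∣⇒p≡q {p = outside ∷ p} {inside ∷ q}  p⊆q ∣q∣≤∣p∣ =
  contradiction (≤-trans ∣q∣≤∣p∣ (p⊆q⇒∣p∣≤∣q∣ (drop-∷-⊆ p⊆q))) (<-irrefl refl)
p⊆q∧∣q∣≤∣p∣⇒p≡q {p = inside ∷ p}  {outside ∷ q} p⊆q _       with () ← p⊆q here
p⊆q∧∣q∣≤∣p∣⇒p≡q {p = inside ∷ p}  {inside ∷ q}  p⊆q ∣q∣≤∣p∣ =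
  cong (inside ∷_) (p⊆q∧∣q∣≤∣p∣⇒p≡q (drop-∷-⊆ p⊆q) (s≤s⁻¹ ∣q∣≤∣p∣))

x∈p⇒∣p∣≡1+∣p-x∣ : ∀ {p : Subset n} {x} → x ∈ p → ∣ p ∣ ≡ suc ∣ p - x ∣
x∈p⇒∣p∣≡1+∣p-x∣ {p = inside ∷ p}  here        = cong (suc ∘ ∣_∣) (sym (p─⊥≡p p))
x∈p⇒∣p∣≡1+∣p-x∣ {p = inside ∷ p}  (there x∈p) = cong suc (x∈p⇒∣p∣≡1+∣p-x∣ x∈p)
x∈p⇒∣p∣≡1+∣p-x∣ {p = outside ∷ p} (there x∈p) = x∈p⇒∣p∣≡1+∣p-x∣ x∈p

x∉p⇒∣p∣<∣p∪⁅x⁆∣ : ∀ {p : Subset n} {x} → x ∉ p → ∣ p ∣ < ∣ p ∪ ⁅ x ⁆ ∣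
x∉p⇒∣p∣<∣p∪⁅x⁆∣ {x = x} x∉p = p⊂q⇒∣p∣<∣q∣ (p⊆p∪q ⁅ x ⁆ , x , q⊆p∪q _ ⁅ x ⁆ (x∈⁅x⁆ x) , x∉p)

p⊆q∧x∈q⇒p∪⁅x⁆⊆q : ∀ {p q : Subset n} {x} → p ⊆ q → x ∈ q → p ∪ ⁅ x ⁆ ⊆ q
p⊆q∧x∈q⇒p∪⁅x⁆⊆q {p = p} {x = x} p⊆q x∈q y∈ with x∈p∪q⁻ p ⁅ x ⁆ y∈
... | inj₁ y∈p = p⊆q y∈p
... | inj₂ y∈x = subst (_∈ _) (sym (x∈⁅y⁆⇒x≡y x y∈x)) x∈q

p⊆q⇒p∪⁅x⁆⊆q∪⁅x⁆ : ∀ {p q : Subset n} {x} → p ⊆ q → p ∪ ⁅ x ⁆ ⊆ q ∪ ⁅ x ⁆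
p⊆q⇒p∪⁅x⁆⊆q∪⁅x⁆ {q = q} {x} p⊆q =
  p⊆q∧x∈q⇒p∪⁅x⁆⊆q (⊆-trans p⊆q (p⊆p∪q ⁅ x ⁆)) (q⊆p∪q q ⁅ x ⁆ (x∈⁅x⁆ x))

p⊆p-x∪⁅x⁆ : ∀ (p : Subset n) x → p ⊆ (p - x) ∪ ⁅ x ⁆
p⊆p-x∪⁅x⁆ p x {y} y∈p with y ≟ᶠ x
... | yes refl = q⊆p∪q _ ⁅ x ⁆ (x∈⁅x⁆ x)
... | no y≢x   = p⊆p∪q ⁅ x ⁆ (x∈p∧x≢y⇒x∈p-y y∈p y≢x)

∁p-x⊆∁[p∪⁅x⁆] : ∀ (p : Subset n) x → ∁ p - x ⊆ ∁ (p ∪ ⁅ x ⁆)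
∁p-x⊆∁[p∪⁅x⁆] p x y∈ with x∈p─q⁻ (∁ p) ⁅ x ⁆ y∈
... | y∈∁p , y∉x = x∉p⇒x∈∁p ([ x∈∁p⇒x∉p y∈∁p , y∉x ]′ ∘ x∈p∪q⁻ p ⁅ x ⁆)

p⊆q⇒p-x⊆q-x : ∀ {p q : Subset n} {x} → p ⊆ q → p - x ⊆ q - x
p⊆q⇒p-x⊆q-x {p = p} {x = x} p⊆q y∈p-x with y∈p , y∉x ← x∈p─q⁻ p ⁅ x ⁆ y∈p-x =
  x∈p∧x∉q⇒x∈p─q (p⊆q y∈p) y∉x

p⊆∁q⇒q⊆∁p : ∀ {p q : Subset n} → p ⊆ ∁ q → q ⊆ ∁ p
p⊆∁q⇒q⊆∁p p⊆∁q y∈q = x∉p⇒x∈∁p λ y∈p → x∈∁p⇒x∉p (p⊆∁q y∈p) y∈q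

p∩q≢∅∧p⊆r⇒q∩r≢∅ : ∀ {p q r : Subset n} → Nonempty (p ∩ q) → p ⊆ r → Nonempty (q ∩ r)
p∩q≢∅∧p⊆r⇒q∩r≢∅ {p = p} {q} (x , x∈p∩q) p⊆r =
  x , x∈p∩q⁺ (proj₂ (x∈p∩q⁻ p q x∈p∩q) , p⊆r (proj₁ (x∈p∩q⁻ p q x∈p∩q)))

∣p∣≡1⇒∃! : ∀ {p : Subset n} → ∣ p ∣ ≡ 1 → ∃[ x ] (x ∈ p × (∀ {y} → y ∈ p → y ≡ x))
∣p∣≡1⇒∃! {p = inside ∷ p} ∣p∣≡1 = zero , here , λ
  { here → refl
  ; (there y∈p) → contradiction (<-≤-trans (x∈p⇒∣p-x∣<∣p∣ y∈p) (≤-reflexive (suc-injective ∣p∣≡1))) n≮0 }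
∣p∣≡1⇒∃! {p = outside ∷ p} ∣p∣≡1 with x , x∈p , unique ← ∣p∣≡1⇒∃! {p = p} ∣p∣≡1 =
  suc x , there x∈p , λ { (there y∈p) → cong suc (unique y∈p) }

∈-tabulate⇔ : (g : Fin n → Bool) {x : Fin n} → x ∈ tabulate g ⇔ T (g x)
∈-tabulate⇔ g {x} = mk⇔
  (λ x∈ → Equivalence.from T-≡ (trans (sym (lookup∘tabulate g x)) ([]=⇒lookup x∈)))
  (λ t → lookup⇒[]= x (tabulate g) (trans (lookup∘tabulate g x) (Equivalence.to T-≡ t)))

∈⇔T-lookup : ∀ {p : Subset n} {x} → x ∈ p ⇔ T (lookup p x)
∈⇔T-lookup {p = p} {x} = mk⇔
  (λ x∈p → Equivalence.from T-≡ ([]=⇒lookup x∈p))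
  (λ t → lookup⇒[]= x p (Equivalence.to T-≡ t))

indicesContaining : (Fin k → Subset n) → Subset k → Fin n → Subset k
indicesContaining E I x = tabulate λ j → lookup I j ∧ lookup (E j) x

∈-indicesContaining⇔ : ∀ (E : Fin k → Subset n) I {x j} →
                       j ∈ indicesContaining E I x ⇔ (j ∈ I × x ∈ E j)
∈-indicesContaining⇔ E I {x} {j} = mk⇔
  (λ j∈ → let (tI , tE) = Equivalence.to T-∧ (Equivalence.to (∈-tabulate⇔ _) j∈) in
          Equivalence.from ∈⇔T-lookup tI , Equivalence.from ∈⇔T-lookup tE)
  (λ (j∈I , x∈Ej) → Equivalence.from (∈-tabulate⇔ _)
          (Equivalence.from T-∧ (Equivalence.to ∈⇔T-lookup j∈I , Equivalence.to ∈⇔T-lookup x∈Ej)))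

x∈⋁⁻ : ∀ (E : Fin k → Subset n) I {x} → x ∈ ⋁ E I →
       ∃[ j ] (j ∈ I × x ∈ E j × (∀ {i} → i ∈ I → x ∈ E i → i ≡ j))
x∈⋁⁻ E I {x} x∈⋁
  with j , j∈ , unique ← ∣p∣≡1⇒∃! (toWitness {a? = ∣ indicesContaining E I x ∣ ≟ 1}
                                     (Equivalence.to (∈-tabulate⇔ _) x∈⋁))
  = let (j∈I , x∈Ej) = Equivalence.to (∈-indicesContaining⇔ E I) j∈ in
    j , j∈I , x∈Ej , λ i∈I x∈Ei → unique (Equivalence.from (∈-indicesContaining⇔ E I) (i∈I , x∈Ei))

InQ-induction : ∀ (E : Fin k → Subset n) {D} → InQ E D → (P : Subset n → Set) → P ⊥ →
       (∀ {T d} j → d ∈ E j → E j ⊆ ∁ T → P T → P (T ∪ ⁅ d ⁆)) → P D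
InQ-induction {k} {n} E {D} (∣D∣≡k , D-meets-⋁) P P⊥ P-step =
  go k ⊤ ⊥ (∣⊤∣≡n k) ⊥⊆ (λ _ _ → x∉p⇒x∈∁p ∉⊥) (≤-reflexive (sym (cong₂ _+_ (∣⊥∣≡0 n) (∣⊤∣≡n k)))) P⊥
  where
  exhausted : ∀ {I T} → Empty I → T ⊆ D → k ≤ ∣ T ∣ + ∣ I ∣ → T ≡ D
  exhausted {I} {T} I-empty T⊆D k≤ = p⊆q∧∣q∣≤∣p∣⇒p≡q T⊆D (begin
    ∣ D ∣             ≡⟨ ∣D∣≡k ⟩
    k                 ≤⟨ k≤ ⟩
    ∣ T ∣ + ∣ I ∣     ≡⟨ cong (λ J → ∣ T ∣ + ∣ J ∣) (Empty-unique I-empty) ⟩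
    ∣ T ∣ + ∣ ⊥ {k} ∣ ≡⟨ cong (∣ T ∣ +_) (∣⊥∣≡0 k) ⟩
    ∣ T ∣ + 0         ≡⟨ +-identityʳ ∣ T ∣ ⟩
    ∣ T ∣             ∎)
    where open ≤-Reasoning

  go : ∀ m I T → ∣ I ∣ ≡ m → T ⊆ D → (∀ {i} → i ∈ I → E i ⊆ ∁ T) → k ≤ ∣ T ∣ + ∣ I ∣ → P T → P D
  go m I T ∣I∣≡m T⊆D I-avoids-T k≤ PT with nonempty? I
  ... | no I-empty = subst P (exhausted I-empty T⊆D k≤) PT
  ... | yes (i , i∈I) with m
  ...   | zero = contradiction (<-≤-trans (x∈p⇒∣p-x∣<∣p∣ i∈I) (≤-reflexive ∣I∣≡m)) n≮0
  ...   | suc m with d , d∈D∩⋁ ← D-meets-⋁ I (i , i∈I)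
                 with d∈D , d∈⋁ ← x∈p∩q⁻ D (⋁ E I) d∈D∩⋁
                 with j , j∈I , d∈Ej , d-only-in-Ej ← x∈⋁⁻ E I d∈⋁ =
    go m (I - j) (T ∪ ⁅ d ⁆) ∣I-j∣≡m (p⊆q∧x∈q⇒p∪⁅x⁆⊆q T⊆D d∈D) I-j-avoids k≤′
       (P-step j d∈Ej (I-avoids-T j∈I) PT)
    where
    d∉T : d ∉ T
    d∉T = x∈∁p⇒x∉p (I-avoids-T j∈I d∈Ej)

    ∣I-j∣≡m : ∣ I - j ∣ ≡ m
    ∣I-j∣≡m = suc-injective (trans (sym (x∈p⇒∣p∣≡1+∣p-x∣ j∈I)) ∣I∣≡m)

    I-j-avoids : ∀ {i} → i ∈ I - j → E i ⊆ ∁ (T ∪ ⁅ d ⁆)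
    I-j-avoids {i} i∈I-j {x} x∈Ei with i∈I , i∉j ← x∈p─q⁻ I ⁅ j ⁆ i∈I-j =
      x∉p⇒x∈∁p ([ x∈∁p⇒x∉p (I-avoids-T i∈I x∈Ei) , x≢d ]′ ∘ x∈p∪q⁻ T ⁅ d ⁆)
      where
      x≢d : x ∉ ⁅ d ⁆
      x≢d x∈d with refl ← x∈⁅y⁆⇒x≡y d x∈d with refl ← d-only-in-Ej i∈I x∈Ei = i∉j (x∈⁅x⁆ j)

    k≤′ : k ≤ ∣ T ∪ ⁅ d ⁆ ∣ + ∣ I - j ∣
    k≤′ = begin
      k                           ≤⟨ k≤ ⟩
      ∣ T ∣ + ∣ I ∣               ≡⟨ cong (∣ T ∣ +_) (x∈p⇒∣p∣≡1+∣p-x∣ j∈I) ⟩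
      ∣ T ∣ + suc ∣ I - j ∣       ≡⟨ +-suc ∣ T ∣ ∣ I - j ∣ ⟩
      suc ∣ T ∣ + ∣ I - j ∣       ≤⟨ +-monoˡ-≤ ∣ I - j ∣ (x∉p⇒∣p∣<∣p∪⁅x⁆∣ d∉T) ⟩
      ∣ T ∪ ⁅ d ⁆ ∣ + ∣ I - j ∣   ∎
      where open ≤-Reasoning

module _ (M : Matroid n) where
  open Matroid M

  MaximalIndepIn : Subset n → Subset n → Set
  MaximalIndepIn U J = Indep J × J ⊆ U × (∀ {x} → x ∈ U → x ∉ J → ¬ Indep (J ∪ ⁅ x ⁆))

  extend-to-maximal : ∀ {U T} → T ⊆ U → Indep T → ∃[ J ] (T ⊆ J × MaximalIndepIn U J)
  extend-to-maximal {U} {T} T⊆U T-indep = grow n T (m≤m+n n ∣ T ∣) ⊆-refl T⊆U T-indep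
    where
    grow : ∀ fuel J → n ≤ fuel + ∣ J ∣ → T ⊆ J → J ⊆ U → Indep J →
           ∃[ J′ ] (T ⊆ J′ × MaximalIndepIn U J′)
    grow fuel J n≤ T⊆J J⊆U J-indep
      with any? (λ x → x ∈? U ×-dec ¬? (x ∈? J) ×-dec indep? (J ∪ ⁅ x ⁆))
    ... | no maximal =
      J , T⊆J , J-indep , J⊆U , λ x∈U x∉J J+x-indep → maximal (_ , x∈U , x∉J , J+x-indep)
    ... | yes (x , x∈U , x∉J , J+x-indep) with fuel
    ...   | zero =
      contradiction (<-≤-trans (x∉p⇒∣p∣<∣p∪⁅x⁆∣ x∉J) (≤-trans (∣p∣≤n (J ∪ ⁅ x ⁆)) n≤)) (<-irrefl refl)
    ...   | suc fuel =
      grow fuel (J ∪ ⁅ x ⁆) n≤′ (⊆-trans T⊆J (p⊆p∪q ⁅ x ⁆)) (p⊆q∧x∈q⇒p∪⁅x⁆⊆q J⊆U x∈U) J+x-indep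
      where
      n≤′ : n ≤ fuel + ∣ J ∪ ⁅ x ⁆ ∣
      n≤′ = ≤-trans n≤ (≤-trans (≤-reflexive (sym (+-suc fuel ∣ J ∣)))
                                (+-monoʳ-≤ fuel (x∉p⇒∣p∣<∣p∪⁅x⁆∣ x∉J)))

  basis⇒∣A∣≤∣B∣ : ∀ {A B} → IsBasis M B → Indep A → ∣ A ∣ ≤ ∣ B ∣
  basis⇒∣A∣≤∣B∣ {A} {B} (B-indep , B-maximal) A-indep with ∣ A ∣ ≤? ∣ B ∣
  ... | yes ∣A∣≤∣B∣ = ∣A∣≤∣B∣
  ... | no ∣A∣≰∣B∣ with x , _ , x∉B , B+x-indep ← indep-aug B-indep A-indep (≰⇒> ∣A∣≰∣B∣) =
    contradiction (subst (x ∈_) (B-maximal _ B+x-indep (p⊆p∪q ⁅ x ⁆)) (q⊆p∪q B ⁅ x ⁆ (x∈⁅x⁆ x))) x∉B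

  indep∧bound≤∣J∣⇒basis : ∀ {J} s → (∀ A → Indep A → ∣ A ∣ ≤ s) → Indep J → s ≤ ∣ J ∣ → IsBasis M J
  indep∧bound≤∣J∣⇒basis s bound J-indep s≤∣J∣ =
    J-indep , λ A A-indep J⊆A → sym (p⊆q∧∣q∣≤∣p∣⇒p≡q J⊆A (≤-trans (bound A A-indep) s≤∣J∣))

  basis⇒∣B∣≡rank : ∀ {B r} → IsRank M r → IsBasis M B → ∣ B ∣ ≡ r
  basis⇒∣B∣≡rank (bound , A , A-indep , ∣A∣≡r) B-basis =
    ≤-antisym (bound _ (proj₁ B-basis)) (subst (_≤ _) ∣A∣≡r (basis⇒∣A∣≤∣B∣ B-basis A-indep))

  circuit-meets-∁-indep : ∀ {A C} → IsCircuit M C → Indep A → Nonempty (C ∩ ∁ A)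
  circuit-meets-∁-indep {A} {C} (C-dependent , _) A-indep with nonempty? (C ∩ ∁ A)
  ... | yes meets = meets
  ... | no disjoint = contradiction (indep-down C⊆A A-indep) C-dependent
    where
    C⊆A : C ⊆ A
    C⊆A {y} y∈C with y ∈? A
    ... | yes y∈A = y∈A
    ... | no y∉A  = contradiction (y , x∈p∩q⁺ (y∈C , x∉p⇒x∈∁p y∉A)) disjoint

  -- d is spanned by C - d ⊆ S - d, so S - d has the rank of S.
  circuit-element-redundant : ∀ {S A C d} → IsCircuit M C → d ∈ C → C ⊆ S → Indep A → A ⊆ S →
                              ∃[ A′ ] (Indep A′ × A′ ⊆ S - d × ∣ A ∣ ≤ ∣ A′ ∣)
  circuit-element-redundant {S} {A} {C} {d} (C-dependent , C-minimal) d∈C C⊆S A-indep A⊆S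
    with J , C-d⊆J , J-indep , J⊆S-d , J-maximal ←
           extend-to-maximal (p⊆q⇒p-x⊆q-x C⊆S) (C-minimal _ (x∈p⇒p-x⊂p d∈C))
    with ∣ A ∣ ≤? ∣ J ∣
  ... | yes ∣A∣≤∣J∣ = J , J-indep , J⊆S-d , ∣A∣≤∣J∣
  ... | no ∣A∣≰∣J∣
    with x , x∈A , x∉J , J+x-indep ← indep-aug J-indep A-indep (≰⇒> ∣A∣≰∣J∣)
    with x ≟ᶠ d
  ...   | yes refl = contradiction (indep-down C⊆J+d J+x-indep) C-dependent
    where
    C⊆J+d : C ⊆ J ∪ ⁅ d ⁆
    C⊆J+d = ⊆-trans (p⊆p-x∪⁅x⁆ C d) (p⊆q⇒p∪⁅x⁆⊆q∪⁅x⁆ C-d⊆J)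
  ...   | no x≢d = contradiction J+x-indep (J-maximal (x∈p∧x≢y⇒x∈p-y (A⊆S x∈A) x≢d) x∉J)

  -- C - d misses some basis B; augmenting a maximal independent extension of T
  -- inside E - C from B can then only add d.
  indep-∪-cocircuit-element : ∀ {T C d} → IsCocircuit M C → d ∈ C → C ⊆ ∁ T → Indep T → Indep (T ∪ ⁅ d ⁆)
  indep-∪-cocircuit-element {T} {C} {d} (C-meets-bases , C-minimal) d∈C C⊆∁T T-indep
    with B , B-basis , C-d∩B-empty ← C-minimal (C - d) (x∈p⇒p-x⊂p d∈C)
    with J , T⊆J , J-indep , J⊆∁C , J-maximal ← extend-to-maximal (p⊆∁q⇒q⊆∁p C⊆∁T) T-indep
    with ∣ B ∣ ≤? ∣ J ∣
  ... | yes ∣B∣≤∣J∣ =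
    let J-basis = indep∧bound≤∣J∣⇒basis ∣ B ∣ (λ _ → basis⇒∣A∣≤∣B∣ B-basis) J-indep ∣B∣≤∣J∣
        y , y∈C∩J = C-meets-bases J J-basis
        y∈C , y∈J = x∈p∩q⁻ C J y∈C∩J
    in contradiction y∈C (x∈∁p⇒x∉p (J⊆∁C y∈J))
  ... | no ∣B∣≰∣J∣
    with x , x∈B , x∉J , J+x-indep ← indep-aug J-indep (proj₁ B-basis) (≰⇒> ∣B∣≰∣J∣)
    with x ∈? C
  ...   | no x∉C = contradiction J+x-indep (J-maximal (x∉p⇒x∈∁p x∉C) x∉J)
  ...   | yes x∈C with x ≟ᶠ d
  ...     | yes refl = indep-down (p⊆q⇒p∪⁅x⁆⊆q∪⁅x⁆ T⊆J) J+x-indep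
  ...     | no x≢d = contradiction (x , x∈p∩q⁺ (x∈p∧x≢y⇒x∈p-y x∈C x≢d , x∈B)) C-d∩B-empty

  IsBasis⇒InQ-∁ : ∀ (E : Fin k → Subset n) {r B} → IsRank M r → k + r ≡ n →
                  (∀ I → Nonempty I → ∃[ C ] (IsCircuit M C × C ⊆ ⋁ E I)) →
                  IsBasis M B → InQ E (∁ B)
  IsBasis⇒InQ-∁ {k} E {r} {B} rank k+r≡n circuit-in-⋁ B-basis = ∣∁B∣≡k , ∁B-meets-⋁
    where
    ∣∁B∣≡k : ∣ ∁ B ∣ ≡ k
    ∣∁B∣≡k = begin
      ∣ ∁ B ∣    ≡⟨ ∣∁p∣≡n∸∣p∣ B ⟩
      n ∸ ∣ B ∣  ≡⟨ cong (n ∸_) (basis⇒∣B∣≡rank rank B-basis) ⟩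
      n ∸ r      ≡⟨ cong (_∸ r) (sym k+r≡n) ⟩
      k + r ∸ r  ≡⟨ m+n∸n≡m k r ⟩
      k          ∎
      where open ≡-Reasoning

    ∁B-meets-⋁ : ∀ I → Nonempty I → Nonempty (∁ B ∩ ⋁ E I)
    ∁B-meets-⋁ I I≢∅ with C , C-circuit , C⊆⋁ ← circuit-in-⋁ I I≢∅ =
      p∩q≢∅∧p⊆r⇒q∩r≢∅ (circuit-meets-∁-indep C-circuit (proj₁ B-basis)) C⊆⋁

  InQ⇒IsBasis-∁ : ∀ (E : Fin k → Subset n) {r D} → IsRank M r → k + r ≡ n →
                  (∀ i → IsUnionOf (IsCircuit M) (E i)) → InQ E D → IsBasis M (∁ D)
  InQ⇒IsBasis-∁ {k} E {r} {D} (bound , A₀ , A₀-indep , ∣A₀∣≡r) k+r≡n E-circuits D∈Q@(∣D∣≡k , _) =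
    full-rank⇒basis (InQ-induction E D∈Q FullRankOutside FullRankOutside-⊥ step)
    where
    FullRankOutside : Subset n → Set
    FullRankOutside T = ∃[ A ] (Indep A × A ⊆ ∁ T × r ≤ ∣ A ∣)

    FullRankOutside-⊥ : FullRankOutside ⊥
    FullRankOutside-⊥ = A₀ , A₀-indep , (λ _ → x∉p⇒x∈∁p ∉⊥) , ≤-reflexive (sym ∣A₀∣≡r)

    step : ∀ {T d} j → d ∈ E j → E j ⊆ ∁ T → FullRankOutside T → FullRankOutside (T ∪ ⁅ d ⁆)
    step {T} {d} j d∈Ej Ej⊆∁T (A , A-indep , A⊆∁T , r≤∣A∣)
      with C , C-circuit , d∈C , C⊆Ej ← E-circuits j d d∈Ej
      with A′ , A′-indep , A′⊆∁T-d , ∣A∣≤∣A′∣ ←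
             circuit-element-redundant C-circuit d∈C (⊆-trans C⊆Ej Ej⊆∁T) A-indep A⊆∁T
      = A′ , A′-indep , ⊆-trans A′⊆∁T-d (∁p-x⊆∁[p∪⁅x⁆] T d) , ≤-trans r≤∣A∣ ∣A∣≤∣A′∣

    ∣∁D∣≡r : ∣ ∁ D ∣ ≡ r
    ∣∁D∣≡r = begin
      ∣ ∁ D ∣    ≡⟨ ∣∁p∣≡n∸∣p∣ D ⟩
      n ∸ ∣ D ∣  ≡⟨ cong₂ _∸_ (sym k+r≡n) ∣D∣≡k ⟩
      k + r ∸ k  ≡⟨ m+n∸m≡n k r ⟩
      r          ∎
      where open ≡-Reasoning

    full-rank⇒basis : FullRankOutside D → IsBasis M (∁ D)
    full-rank⇒basis (A , A-indep , A⊆∁D , r≤∣A∣) =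
      subst (IsBasis M) (p⊆q∧∣q∣≤∣p∣⇒p≡q A⊆∁D (≤-trans (≤-reflexive ∣∁D∣≡r) r≤∣A∣))
            (indep∧bound≤∣J∣⇒basis r bound A-indep r≤∣A∣)

  IsBasis⇒InQ : ∀ (E : Fin k → Subset n) {r B} → IsRank M r → k ≡ r →
                (∀ I → Nonempty I → ∃[ C ] (IsCocircuit M C × C ⊆ ⋁ E I)) →
                IsBasis M B → InQ E B
  IsBasis⇒InQ E rank k≡r cocircuit-in-⋁ B-basis =
    trans (basis⇒∣B∣≡rank rank B-basis) (sym k≡r) ,
    λ I I≢∅ → let C , C-cocircuit , C⊆⋁ = cocircuit-in-⋁ I I≢∅ in
              p∩q≢∅∧p⊆r⇒q∩r≢∅ (proj₁ C-cocircuit _ B-basis) C⊆⋁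

  InQ⇒IsBasis : ∀ (E : Fin k → Subset n) {r D} → IsRank M r → k ≡ r →
                (∀ i → IsUnionOf (IsCocircuit M) (E i)) → InQ E D → IsBasis M D
  InQ⇒IsBasis E {r} (bound , _) k≡r E-cocircuits D∈Q@(∣D∣≡k , _) =
    indep∧bound≤∣J∣⇒basis r bound (InQ-induction E D∈Q Indep indep-empty step)
                          (≤-reflexive (sym (trans ∣D∣≡k k≡r)))
    where
    step : ∀ {T d} j → d ∈ E j → E j ⊆ ∁ T → Indep T → Indep (T ∪ ⁅ d ⁆)
    step {d = d} j d∈Ej Ej⊆∁T T-indep with C , C-cocircuit , d∈C , C⊆Ej ← E-cocircuits j d d∈Ej =
      indep-∪-cocircuit-element C-cocircuit d∈C (⊆-trans C⊆Ej Ej⊆∁T) T-indep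

IsBijection-∘-involution : ∀ {A B : Set} {P : A → Set} {Q R : B → Set} {φ : (a : A) → P a → B}
  (g : B → B) → (∀ b → g (g b) ≡ b) → (∀ b → R b ⇔ Q (g b)) →
  IsBijection P Q φ → IsBijection P R (λ a p → g (φ a p))
IsBijection-∘-involution {Q = Q} g g-involutive R⇔Q∘g (φ-irrelevant , φ∈Q , φ-injective , φ-surjective) =
  (λ a p p′ → cong g (φ-irrelevant a p p′)) ,
  (λ a p → Equivalence.from (R⇔Q∘g _) (subst Q (sym (g-involutive _)) (φ∈Q a p))) ,
  (λ a a′ p p′ eq → φ-injective a a′ p p′ (g-injective eq)) ,
  λ c c∈R → let a , p , φap≡gc = φ-surjective (g c) (Equivalence.to (R⇔Q∘g c) c∈R) in
            a , p , trans (cong g φap≡gc) (g-involutive c)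
  where
  g-injective : ∀ {b b′} → g b ≡ g b′ → b ≡ b′
  g-injective {b} {b′} eq = trans (sym (g-involutive b)) (trans (cong g eq) (g-involutive b′))

corollary4p6 : ∀ {n k : ℕ} (M : Matroid n) (E : Fin k → Subset n)
    (φ : (f : Vec ℕ k) → InP E f → Subset n) →
    IsBijection (InP E) (InQ E) φ →
    ((∃[ r ] (IsRank M r × k + r ≡ n)) →
    (∀ i → IsUnionOf (IsCircuit M) (E i)) →
    (∀ I → Nonempty I → ∃[ C ] (IsCircuit M C × C ⊆ ⋁ E I)) →
    (∀ B → IsBasis M B ⇔ (∃[ D ] (InQ E D × B ≡ ∁ D)))
    × IsBijection (InP E) (IsBasis M) (λ f p → ∁ (φ f p)))
    × ((∃[ r ] (IsRank M r × k ≡ r)) →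
    (∀ i → IsUnionOf (IsCocircuit M) (E i)) →
    (∀ I → Nonempty I → ∃[ C ] (IsCocircuit M C × C ⊆ ⋁ E I)) →
    (∀ B → IsBasis M B ⇔ InQ E B)
    × IsBijection (InP E) (IsBasis M) φ)
corollary4p6 M E φ φ-bijective =
  (λ (_ , rank , k+r≡n) E-circuits circuit-in-⋁ →
    let to : ∀ {B} → IsBasis M B → InQ E (∁ B)
        to = IsBasis⇒InQ-∁ M E rank k+r≡n circuit-in-⋁
        from : ∀ {D} → InQ E D → IsBasis M (∁ D)
        from = InQ⇒IsBasis-∁ M E rank k+r≡n E-circuits
    in (λ B → mk⇔ (λ B-basis → ∁ B , to B-basis , sym (∁-involutive B))
                  (λ { (D , D∈Q , refl) → from D∈Q })) ,
       IsBijection-∘-involution ∁ ∁-involutive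
         (λ B → mk⇔ to (λ ∁B∈Q → subst (IsBasis M) (∁-involutive B) (from ∁B∈Q))) φ-bijective) ,
  (λ (_ , rank , k≡r) E-cocircuits cocircuit-in-⋁ →
    let bases⇔𝒬 : ∀ B → IsBasis M B ⇔ InQ E B
        bases⇔𝒬 _ = mk⇔ (IsBasis⇒InQ M E rank k≡r cocircuit-in-⋁) (InQ⇒IsBasis M E rank k≡r E-cocircuits)
    in bases⇔𝒬 , IsBijection-∘-involution (λ B → B) (λ _ → refl) bases⇔𝒬 φ-bijective)
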